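{- Let $r,p,q,n$ be positive integers with $p\mid r$, $q\mid r$, $pq\mid rn$, and suppose $\mathrm{GCD}(\frac{rn}{pq},\frac rq)=\mathrm{GCD}(\frac{rn}{pq},\frac rp)=\delta_1\delta_2$, where $\delta_1$ is a product of primes (with multiplicity) each appearing with the same multiplicity in the prime factorizations of $p$ and $q$, and $\delta_2$ is a product of primes each appearing with different multiplicities in the prime factorizations of $p$ and $q$. Then $$G(r,p,q,n)\cong G(r,\delta_2p,q,n)\times C_{\delta_2},$$ where $C_{\delta_2}$ is the cyclic group of order $\delta_2$.
   Context: $G(r,n)$ is the group of $n\times n$ complex matrices with exactly one nonzero entry in each row and column, each an $r$-th root of unity. For $p\mid r$, $G(r,p,n)$ is the subgroup of $A\in G(r,n)$ with $\det A/\det|A|$ an $(r/p)$-th root of unity ($|A|$ the matrix of absolute values). For $q\mid r$, $pq\mid rn$, $G(r,p,q,n)=G(r,p,n)/\langle e^{2\pi i/q}I\rangle$. -}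

module Defs where

open import Level using (0ℓ)
open import Data.Nat as ℕ using (ℕ; zero; suc; NonZero; _^_)
open import Data.Nat.DivMod using (_/_)
open import Data.Nat.Divisibility as ℕD using ()
open import Data.Nat.Primality using (Prime)
open import Data.Integer as ℤ using (ℤ; +_)
open import Data.Integer.Divisibility as ℤD using ()
open import Data.Fin using (Fin; zero; suc)
open import Data.Fin.Permutation using (Permutation′; _⟨$⟩ʳ_; _∘ₚ_)
open import Data.Product using (Σ; ∃; _×_; _,_)
open import Data.Unit using (⊤)
open import Relation.Binary.PropositionalEquality using (_≡_)

SameMultiplicity : ℕ → ℕ → ℕ → Set
SameMultiplicity ℓ a b = ∀ k → (ℓ ^ k ℕD.∣ a → ℓ ^ k ℕD.∣ b) × (ℓ ^ k ℕD.∣ b → ℓ ^ k ℕD.∣ a)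

-- "Groups" presented as: a carrier, a membership predicate (the elements
-- of the group), an equivalence (equality in the group, allowing quotients),
-- and a multiplication.

record GroupPres : Set₁ where
  field
    Carrier : Set
    Mem     : Carrier → Set
    _≈_     : Carrier → Carrier → Set
    _∙_     : Carrier → Carrier → Carrier

open GroupPres

record _≅_ (G H : GroupPres) : Set where
  field
    f      : (x : Carrier G) → Mem G x → Carrier H
    f-mem  : ∀ x (mx : Mem G x) → Mem H (f x mx)
    f-cong : ∀ x y (mx : Mem G x) (my : Mem G y) →
             _≈_ G x y → _≈_ H (f x mx) (f y my)
    f-inj  : ∀ x y (mx : Mem G x) (my : Mem G y) →
             _≈_ H (f x mx) (f y my) → _≈_ G x y
    f-surj : ∀ y → Mem H y → Σ (Carrier G) λ x → Σ (Mem G x) λ mx → _≈_ H (f x mx) y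
    f-hom  : ∀ x y (mx : Mem G x) (my : Mem G y) (mxy : Mem G (_∙_ G x y)) →
             _≈_ H (f (_∙_ G x y) mxy) (_∙_ H (f x mx) (f y my))

_⊗_ : GroupPres → GroupPres → GroupPres
G ⊗ H = record
  { Carrier = Carrier G × Carrier H
  ; Mem     = λ { (x , y) → Mem G x × Mem H y }
  ; _≈_     = λ { (x , y) (x′ , y′) → _≈_ G x x′ × _≈_ H y y′ }
  ; _∙_     = λ { (x , y) (x′ , y′) → (_∙_ G x x′ , _∙_ H y y′) }
  }

_≡[_]_ : ℤ → ℕ → ℤ → Set
a ≡[ m ] b = (+ m) ℤD.∣ (a ℤ.- b)

C : ℕ → GroupPres
C d = record
  { Carrier = ℤ
  ; Mem     = λ _ → ⊤
  ; _≈_     = λ a b → a ≡[ d ] b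
  ; _∙_     = ℤ._+_
  }

-- A pair (σ , a) represents the n×n matrix whose (i , σ i) entry is
-- ζ_r ^ (a i) (ζ_r = e^{2πi/r}) and all other entries are 0.
-- Matrix product: (σ , a)(τ , b) has (i , τ (σ i)) entry ζ^(a i + b (σ i)),
-- i.e. it is (σ ∘ₚ τ , λ i → a i + b (σ i))  (σ ∘ₚ τ applies σ first).
-- det A / det|A| = ζ_r ^ (Σ a i).

Mon : ℕ → Set
Mon n = Permutation′ n × (Fin n → ℤ)

sumℤ : ∀ {n} → (Fin n → ℤ) → ℤ
sumℤ {zero}  a = + 0
sumℤ {suc n} a = a zero ℤ.+ sumℤ (λ i → a (suc i))

_·M_ : ∀ {n} → Mon n → Mon n → Mon n
(σ , a) ·M (τ , b) = (σ ∘ₚ τ , λ i → a i ℤ.+ b (σ ⟨$⟩ʳ i))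

-- G(r,p,q,n) = G(r,p,n) / ⟨ζ_q I⟩.
--  * Membership in G(r,p,n): det A/det|A| = ζ_r^(Σ a) is an (r/p)-th root
--    of unity, i.e. (r/p)·Σa ≡ 0 mod r, i.e. p ∣ Σ a (for p ∣ r).
--  * ζ_q I = ζ_r^(r/q) I, so (σ,a) ~ (τ,b) iff σ = τ and for some k,
--    a i ≡ b i + k·(r/q) (mod r) for all i (entries are equal as complex
--    numbers iff exponents agree mod r).
G : (r p q n : ℕ) → .{{NonZero q}} → GroupPres
G r p q n = record
  { Carrier = Mon n
  ; Mem     = λ { (σ , a) → (+ p) ℤD.∣ sumℤ a }
  ; _≈_     = λ { (σ , a) (τ , b) →
                  (∀ i → σ ⟨$⟩ʳ i ≡ τ ⟨$⟩ʳ i) ×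
                  ∃ λ (k : ℤ) → ∀ i → a i ≡[ r ] (b i ℤ.+ k ℤ.* (+ (r / q))) }
  ; _∙_     = _·M_
  }

-- Put u = r/q, w = r/p and M = rn/(pq). As δ₂ divides gcd(M, u) and gcd(M, w), write
-- M = t δ₂, u = e δ₂, w = e′ δ₂; then n e = p t, p e′ = q e and δ₁ = gcd(t, e) = gcd(t, e′).
-- A prime dividing both t and δ₂ divides neither e nor e′ (it would divide δ₁), so p e′ = q e
-- gives it the same multiplicity in p and q, which is excluded for primes dividing δ₂.
-- Hence t is coprime to δ₂, and Bézout gives c′ with t c′ ≡ 1 (mod δ₂). For c = e c′ this means
-- n c ≡ p (mod δ₂ p) and δ₂ c = c′ u. Writing Σ a = j p for (σ, a) ∈ G(r,p,q,n), the map
-- (σ, a) ↦ ((σ, a − j c), j mod δ₂) is the isomorphism: the first congruence puts the corrected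
-- matrix into G(r, δ₂ p, n), and the second turns a change of j by δ₂ into a multiplication by a
-- power of ζ_q I. Modulo ⟨ζ_q I⟩ the sum Σ a is only defined up to multiples of n u (mod r), and
-- δ₂ p divides both r and n u, so j mod δ₂ is well defined.

module Submission where

module Splitting where

  open import Defs
  open import Data.Nat as ℕ using (ℕ; zero; suc)
  import Data.Nat.Divisibility as ℕ
  open import Data.Nat.DivMod using (_/_)
  open import Data.Nat.Coprimality using (Coprime; coprime-Bézout)
  open import Data.Nat.GCD using (module Bézout)
  open import Data.Integer using (ℤ; +_; 1ℤ; _+_; _*_; _-_; -_)
  open import Data.Integer.Properties
    using (pos-*; *-cancelʳ-≡; neg-distrib-+; suc-*; +-inverseʳ; *-distribʳ-+; *-comm; *-assoc; +-0-commutativeMonoid)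
  import Data.Integer.Divisibility as Unsigned
  open import Data.Integer.Divisibility.Signed
    using (_∣_; divides; ∣ᵤ⇒∣; ∣⇒∣ᵤ; ∣m∣n⇒∣m+n; *-cancelˡ-∣; ∣-trans)
  open import Data.Integer.Tactic.RingSolver using (solve-∀)
  open import Data.Fin using (Fin; zero; suc)
  open import Data.Fin.Permutation using (Permutation′; _⟨$⟩ʳ_)
  open import Data.Product using (Σ; ∃₂; _,_)
  open import Data.Unit using (tt)
  open import Relation.Binary.PropositionalEquality
    using (_≡_; refl; sym; trans; cong; cong₂; subst; subst₂; module ≡-Reasoning)
  open import Algebra.Properties.CommutativeMonoid.Sum +-0-commutativeMonoid
    using (sum; ∑-distrib-+; sum-permute)

  sumℤ≡sum : ∀ {n} (a : Fin n → ℤ) → sumℤ a ≡ sum a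
  sumℤ≡sum {zero}  a = refl
  sumℤ≡sum {suc n} a = cong (λ s → a zero + s) (sumℤ≡sum (λ i → a (suc i)))

  sumℤ-+ : ∀ {n} (a b : Fin n → ℤ) → sumℤ (λ i → a i + b i) ≡ sumℤ a + sumℤ b
  sumℤ-+ a b = begin
    sumℤ (λ i → a i + b i) ≡⟨ sumℤ≡sum (λ i → a i + b i) ⟩
    sum (λ i → a i + b i)  ≡⟨ ∑-distrib-+ a b ⟩
    sum a + sum b          ≡⟨ cong₂ _+_ (sumℤ≡sum a) (sumℤ≡sum b) ⟨
    sumℤ a + sumℤ b        ∎
    where open ≡-Reasoning

  sumℤ-permute : ∀ {n} (a : Fin n → ℤ) (σ : Permutation′ n) → sumℤ (λ i → a (σ ⟨$⟩ʳ i)) ≡ sumℤ a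
  sumℤ-permute a σ = begin
    sumℤ (λ i → a (σ ⟨$⟩ʳ i)) ≡⟨ sumℤ≡sum (λ i → a (σ ⟨$⟩ʳ i)) ⟩
    sum (λ i → a (σ ⟨$⟩ʳ i))  ≡⟨ sum-permute a σ ⟨
    sum a                     ≡⟨ sumℤ≡sum a ⟨
    sumℤ a                    ∎
    where open ≡-Reasoning

  sumℤ-neg : ∀ {n} (a : Fin n → ℤ) → sumℤ (λ i → - a i) ≡ - sumℤ a
  sumℤ-neg {zero}  a = refl
  sumℤ-neg {suc n} a = trans (cong (λ s → - a zero + s) (sumℤ-neg (λ i → a (suc i))))
                             (sym (neg-distrib-+ (a zero) (sumℤ (λ i → a (suc i)))))

  sumℤ-const : ∀ n (x : ℤ) → sumℤ {n} (λ _ → x) ≡ + n * x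
  sumℤ-const zero    x = refl
  sumℤ-const (suc n) x = trans (cong (λ s → x + s) (sumℤ-const n x)) (sym (suc-* (+ n) x))

  ∣-sumℤ : ∀ {n} d (a : Fin n → ℤ) → (∀ i → d ∣ a i) → d ∣ sumℤ a
  ∣-sumℤ {zero}  d a d∣a = divides (+ 0) refl
  ∣-sumℤ {suc n} d a d∣a = ∣m∣n⇒∣m+n (d∣a zero) (∣-sumℤ d (λ i → a (suc i)) (λ i → d∣a (suc i)))

  ≡[]-reflexive : ∀ {m x y} → x ≡ y → x ≡[ m ] y
  ≡[]-reflexive {m} {x} refl = ∣⇒∣ᵤ {+ m} (divides (+ 0) (+-inverseʳ x))

  ≡[]-sumℤ : ∀ {n} m (a b : Fin n → ℤ) (x : ℤ) →
             (∀ i → a i ≡[ m ] (b i + x)) → sumℤ a ≡[ m ] (sumℤ b + + n * x)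
  ≡[]-sumℤ {n} m a b x a≡b+x = ∣⇒∣ᵤ (subst (+ m ∣_) sum-of-differences (∣-sumℤ (+ m) _ (λ i → ∣ᵤ⇒∣ (a≡b+x i))))
    where
    sum-of-differences : sumℤ (λ i → a i - (b i + x)) ≡ sumℤ a - (sumℤ b + + n * x)
    sum-of-differences = begin
      sumℤ (λ i → a i - (b i + x))             ≡⟨ sumℤ-+ a (λ i → - (b i + x)) ⟩
      sumℤ a + sumℤ (λ i → - (b i + x))        ≡⟨ cong (λ s → sumℤ a + s) (sumℤ-neg (λ i → b i + x)) ⟩
      sumℤ a - sumℤ (λ i → b i + x)            ≡⟨ cong (λ s → sumℤ a - s) (sumℤ-+ b (λ _ → x)) ⟩
      sumℤ a - (sumℤ b + sumℤ {n} (λ _ → x))   ≡⟨ cong (λ s → sumℤ a - (sumℤ b + s)) (sumℤ-const n x) ⟩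
      sumℤ a - (sumℤ b + + n * x)              ∎
      where open ≡-Reasoning

  shift-identity : ∀ A B K jx jy s D E C′ U → jx ≡ s * D + jy → U ≡ E * D →
    (A - jx * (E * C′)) - ((B - jy * (E * C′)) + K * U) ≡ A - (B + (K + s * C′) * U)
  shift-identity A B K .(s * D + jy) jy s D E C′ .(E * D) refl refl = ring A B K jy s D E C′
    where
    ring : ∀ A B K jy s D E C′ → (A - (s * D + jy) * (E * C′)) - ((B - jy * (E * C′)) + K * (E * D))
                                  ≡ A - (B + (K + s * C′) * (E * D))
    ring = solve-∀

  unshift-identity : ∀ B t m D E C′ U → U ≡ E * D →
    (B + t * (E * C′)) - (m * D + t) * (E * C′) ≡ B + - (m * C′) * U
  unshift-identity B t m D E C′ .(E * D) refl = ring B t m D E C′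
    where
    ring : ∀ B t m D E C′ → (B + t * (E * C′)) - (m * D + t) * (E * C′) ≡ B + - (m * C′) * (E * D)
    ring = solve-∀

  module SplittingIsomorphism (r p q n δ : ℕ) .{{_ : ℕ.NonZero p}} .{{_ : ℕ.NonZero q}}
    (e c′ h : ℤ)
    (u≡eδ : + (r / q) ≡ e * + δ)
    (nec′≡p+hδp : + n * (e * c′) ≡ + p + h * (+ δ * + p))
    (r∣⇒δ∣ : ∀ x k → + r ∣ + p * x - + n * (k * + (r / q)) → + δ ∣ x)
    where

    Source Target : GroupPres
    Source = G r p q n
    Target = G r (δ ℕ.* p) q n ⊗ C δ

    module S = GroupPres Source
    module T = GroupPres Target

    u c P D N : ℤ
    u = + (r / q)
    c = e * c′
    P = + p
    D = + δ
    N = + n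

    sum/p : (a : Fin n → ℤ) → P Unsigned.∣ sumℤ a → ℤ
    sum/p a p∣Σa = _∣_.quotient (∣ᵤ⇒∣ {P} {sumℤ a} p∣Σa)

    sum≡sum/p*p : ∀ a p∣Σa → sumℤ a ≡ sum/p a p∣Σa * P
    sum≡sum/p*p a p∣Σa = _∣_.equality (∣ᵤ⇒∣ {P} {sumℤ a} p∣Σa)

    sum/p-unique : ∀ a p∣Σa j → sumℤ a ≡ j * P → sum/p a p∣Σa ≡ j
    sum/p-unique a p∣Σa j Σa≡jp = *-cancelʳ-≡ _ j P (trans (sym (sum≡sum/p*p a p∣Σa)) Σa≡jp)

    n*jc : ∀ j → N * (j * c) ≡ j * P + j * h * (D * P)
    n*jc j = begin
      N * (j * c)              ≡⟨ ring₁ N j c ⟩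
      j * (N * c)              ≡⟨ cong (j *_) nec′≡p+hδp ⟩
      j * (P + h * (D * P))    ≡⟨ ring₂ j P h (D * P) ⟩
      j * P + j * h * (D * P)  ∎
      where
      open ≡-Reasoning
      ring₁ : ∀ N j c → N * (j * c) ≡ j * (N * c)
      ring₁ = solve-∀
      ring₂ : ∀ j P h X → j * (P + h * X) ≡ j * P + j * h * X
      ring₂ = solve-∀

    split : (x : S.Carrier) → S.Mem x → T.Carrier
    split (σ , a) p∣Σa = (σ , λ i → a i - sum/p a p∣Σa * c) , sum/p a p∣Σa

    split-mem : ∀ x (p∣Σa : S.Mem x) → T.Mem (split x p∣Σa)
    split-mem (σ , a) p∣Σa = ∣⇒∣ᵤ {+ (δ ℕ.* p)} (divides (- (j * h)) Σ≡) , tt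
      where
      j = sum/p a p∣Σa
      ring : ∀ j P N c → j * P + N * - (j * c) ≡ j * P - N * (j * c)
      ring = solve-∀
      ring′ : ∀ j P h X → j * P - (j * P + j * h * X) ≡ - (j * h) * X
      ring′ = solve-∀
      Σ≡ : sumℤ (λ i → a i - j * c) ≡ - (j * h) * + (δ ℕ.* p)
      Σ≡ = begin
        sumℤ (λ i → a i - j * c)             ≡⟨ sumℤ-+ a (λ _ → - (j * c)) ⟩
        sumℤ a + sumℤ {n} (λ _ → - (j * c))  ≡⟨ cong₂ _+_ (sum≡sum/p*p a p∣Σa) (sumℤ-const n (- (j * c))) ⟩
        j * P + N * - (j * c)                ≡⟨ ring j P N c ⟩
        j * P - N * (j * c)                  ≡⟨ cong (λ x → j * P - x) (n*jc j) ⟩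
        j * P - (j * P + j * h * (D * P))    ≡⟨ ring′ j P h (D * P) ⟩
        - (j * h) * (D * P)                  ≡⟨ cong (- (j * h) *_) (pos-* δ p) ⟨
        - (j * h) * + (δ ℕ.* p)              ∎
        where open ≡-Reasoning

    sum-difference : ∀ a b (p∣Σa : P Unsigned.∣ sumℤ a) (p∣Σb : P Unsigned.∣ sumℤ b) X →
                     sumℤ a - (sumℤ b + X) ≡ P * (sum/p a p∣Σa - sum/p b p∣Σb) - X
    sum-difference a b p∣Σa p∣Σb X =
      trans (cong₂ (λ x y → x - (y + X)) (sum≡sum/p*p a p∣Σa) (sum≡sum/p*p b p∣Σb))
            (ring (sum/p a p∣Σa) (sum/p b p∣Σb) P X)
      where
      ring : ∀ jx jy P X → jx * P - (jy * P + X) ≡ P * (jx - jy) - X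
      ring = solve-∀

    δ-shift : ∀ A B K jx jy s → jx - jy ≡ s * D →
              (A - jx * c) - ((B - jy * c) + K * u) ≡ A - (B + (K + s * c′) * u)
    δ-shift A B K jx jy s jx-jy≡sδ = shift-identity A B K jx jy s D e c′ u jx≡sδ+jy u≡eδ
      where
      ring : ∀ jx jy → jx ≡ (jx - jy) + jy
      ring = solve-∀
      jx≡sδ+jy : jx ≡ s * D + jy
      jx≡sδ+jy = trans (ring jx jy) (cong (_+ jy) jx-jy≡sδ)

    split-cong : ∀ x y (mx : S.Mem x) (my : S.Mem y) → x S.≈ y → split x mx T.≈ split y my
    split-cong (σ , a) (τ , b) p∣Σa p∣Σb (σ≗τ , k , a≡b+ku) =
      (σ≗τ , k - s * c′ , λ i → subst (+ r Unsigned.∣_) (realign (a i) (b i)) (a≡b+ku i)) ,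
      ∣⇒∣ᵤ {D} δ∣jx-jy
      where
      jx = sum/p a p∣Σa
      jy = sum/p b p∣Σb
      δ∣jx-jy : D ∣ jx - jy
      δ∣jx-jy = r∣⇒δ∣ (jx - jy) k (subst (+ r ∣_) (sum-difference a b p∣Σa p∣Σb (N * (k * u)))
                  (∣ᵤ⇒∣ (≡[]-sumℤ r a b (k * u) a≡b+ku)))
      s = _∣_.quotient δ∣jx-jy
      ring : ∀ k x → k - x + x ≡ k
      ring = solve-∀
      realign : ∀ A B → A - (B + k * u) ≡ (A - jx * c) - ((B - jy * c) + (k - s * c′) * u)
      realign A B = sym (trans (δ-shift A B (k - s * c′) jx jy s (_∣_.equality δ∣jx-jy))
                               (cong (λ K → A - (B + K * u)) (ring k (s * c′))))

    split-inj : ∀ x y (mx : S.Mem x) (my : S.Mem y) → split x mx T.≈ split y my → x S.≈ y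
    split-inj (σ , a) (τ , b) p∣Σa p∣Σb ((σ≗τ , k , a′≡b′+ku) , jx≡jy[δ]) =
      σ≗τ , k + s * c′ ,
      λ i → subst (+ r Unsigned.∣_) (δ-shift (a i) (b i) k jx jy s (_∣_.equality δ∣jx-jy)) (a′≡b′+ku i)
      where
      jx = sum/p a p∣Σa
      jy = sum/p b p∣Σb
      δ∣jx-jy : D ∣ jx - jy
      δ∣jx-jy = ∣ᵤ⇒∣ {D} {jx - jy} jx≡jy[δ]
      s = _∣_.quotient δ∣jx-jy

    split-surj : ∀ y → T.Mem y → Σ S.Carrier λ x → Σ (S.Mem x) λ mx → split x mx T.≈ y
    split-surj ((τ , b) , t) (δp∣ᵤΣb , _) =
      (τ , b′) , p∣Σb′ ,
      ((λ _ → refl) , - (m * c′) , λ i → ≡[]-reflexive (unshift i)) ,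
      ∣⇒∣ᵤ {D} (divides m (trans (cong (_- t) j≡mδ+t) (ring m D t)))
      where
      δp∣Σb : + (δ ℕ.* p) ∣ sumℤ b
      δp∣Σb = ∣ᵤ⇒∣ {+ (δ ℕ.* p)} {sumℤ b} δp∣ᵤΣb
      β = _∣_.quotient δp∣Σb
      m = β + t * h
      b′ : Fin n → ℤ
      b′ i = b i + t * c
      ring : ∀ m D t → m * D + t - t ≡ m * D
      ring = solve-∀
      ring′ : ∀ β D P t h → β * (D * P) + (t * P + t * h * (D * P)) ≡ ((β + t * h) * D + t) * P
      ring′ = solve-∀
      Σb′≡ : sumℤ b′ ≡ (m * D + t) * P
      Σb′≡ = begin
        sumℤ b′                                   ≡⟨ sumℤ-+ b (λ _ → t * c) ⟩
        sumℤ b + sumℤ {n} (λ _ → t * c)           ≡⟨ cong₂ _+_ (_∣_.equality δp∣Σb) (sumℤ-const n (t * c)) ⟩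
        β * + (δ ℕ.* p) + N * (t * c)             ≡⟨ cong₂ (λ x y → β * x + y) (pos-* δ p) (n*jc t) ⟩
        β * (D * P) + (t * P + t * h * (D * P))   ≡⟨ ring′ β D P t h ⟩
        (m * D + t) * P                           ∎
        where open ≡-Reasoning
      p∣Σb′ : S.Mem (τ , b′)
      p∣Σb′ = ∣⇒∣ᵤ {P} (divides (m * D + t) Σb′≡)
      j≡mδ+t : sum/p b′ p∣Σb′ ≡ m * D + t
      j≡mδ+t = sum/p-unique b′ p∣Σb′ (m * D + t) Σb′≡
      unshift : ∀ i → b′ i - sum/p b′ p∣Σb′ * c ≡ b i + - (m * c′) * u
      unshift i = trans (cong (λ j → b′ i - j * c) j≡mδ+t) (unshift-identity (b i) t m D e c′ u u≡eδ)

    split-hom : ∀ x y (mx : S.Mem x) (my : S.Mem y) (mxy : S.Mem (x S.∙ y)) →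
                split (x S.∙ y) mxy T.≈ (split x mx T.∙ split y my)
    split-hom (σ , a) (τ , b) p∣Σa p∣Σb p∣Σab =
      ((λ _ → refl) , + 0 , λ i → ≡[]-reflexive (distribute (a i) (b (σ ⟨$⟩ʳ i)))) ,
      ≡[]-reflexive jab≡ja+jb
      where
      ja = sum/p a p∣Σa
      jb = sum/p b p∣Σb
      jab≡ja+jb : sum/p _ p∣Σab ≡ ja + jb
      jab≡ja+jb = sum/p-unique _ p∣Σab (ja + jb) (begin
        sumℤ (λ i → a i + b (σ ⟨$⟩ʳ i))    ≡⟨ sumℤ-+ a (λ i → b (σ ⟨$⟩ʳ i)) ⟩
        sumℤ a + sumℤ (λ i → b (σ ⟨$⟩ʳ i)) ≡⟨ cong (λ x → sumℤ a + x) (sumℤ-permute b σ) ⟩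
        sumℤ a + sumℤ b                     ≡⟨ cong₂ _+_ (sum≡sum/p*p a p∣Σa) (sum≡sum/p*p b p∣Σb) ⟩
        ja * P + jb * P                     ≡⟨ *-distribʳ-+ P ja jb ⟨
        (ja + jb) * P                       ∎)
        where open ≡-Reasoning
      ring : ∀ A B ja jb c u → (A + B) - (ja + jb) * c ≡ ((A - ja * c) + (B - jb * c)) + + 0 * u
      ring = solve-∀
      distribute : ∀ A B → (A + B) - sum/p _ p∣Σab * c ≡ ((A - ja * c) + (B - jb * c)) + + 0 * u
      distribute A B = trans (cong (λ j → (A + B) - j * c) jab≡ja+jb) (ring A B ja jb c u)

    split-≅ : Source ≅ Target
    split-≅ = record
      { f = split ; f-mem = split-mem ; f-cong = split-cong ; f-inj = split-inj
      ; f-surj = split-surj ; f-hom = split-hom }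

  1+m*n≡o*p⇒ℤ : ∀ a b c d → 1 ℕ.+ a ℕ.* b ≡ c ℕ.* d → 1ℤ + + a * + b ≡ + c * + d
  1+m*n≡o*p⇒ℤ a b c d eq = begin
    1ℤ + + a * + b    ≡⟨ cong (λ z → 1ℤ + z) (pos-* a b) ⟨
    + (1 ℕ.+ a ℕ.* b) ≡⟨ cong +_ eq ⟩
    + (c ℕ.* d)       ≡⟨ pos-* c d ⟩
    + c * + d         ∎
    where open ≡-Reasoning

  coprime⇒Bézout : ∀ {m n} → Coprime m n → ∃₂ λ x y → + m * x ≡ 1ℤ + + n * y
  coprime⇒Bézout {m} {n} m⊥n with coprime-Bézout m⊥n
  ... | Bézout.+- x y 1+yn≡xm = + x , + y , (begin
    + m * + x       ≡⟨ *-comm (+ m) (+ x) ⟩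
    + x * + m       ≡⟨ 1+m*n≡o*p⇒ℤ y n x m 1+yn≡xm ⟨
    1ℤ + + y * + n  ≡⟨ cong (λ z → 1ℤ + z) (*-comm (+ y) (+ n)) ⟩
    1ℤ + + n * + y  ∎)
    where open ≡-Reasoning
  ... | Bézout.-+ x y 1+xm≡yn = - + x , - + y , (begin
    + m * - + x           ≡⟨ ring₁ (+ m) (+ x) ⟩
    1ℤ - (1ℤ + + x * + m) ≡⟨ cong (λ z → 1ℤ - z) (1+m*n≡o*p⇒ℤ x m y n 1+xm≡yn) ⟩
    1ℤ - + y * + n        ≡⟨ ring₂ (+ n) (+ y) ⟩
    1ℤ + + n * - + y      ∎)
    where
    open ≡-Reasoning
    ring₁ : ∀ M X → M * - X ≡ 1ℤ - (1ℤ + X * M)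
    ring₁ = solve-∀
    ring₂ : ∀ N Y → 1ℤ - Y * N ≡ 1ℤ + N * - Y
    ring₂ = solve-∀

  G-splits : ∀ r p q n δ .{{_ : ℕ.NonZero p}} .{{_ : ℕ.NonZero q}} (e t : ℕ) →
             r / q ≡ e ℕ.* δ → n ℕ.* e ≡ p ℕ.* t → Coprime t δ → δ ℕ.* p ℕ.∣ r →
             G r p q n ≅ (G r (δ ℕ.* p) q n ⊗ C δ)
  G-splits r p q n δ e t u≡eδ ne≡pt t⊥δ δp∣r with coprime⇒Bézout t⊥δ
  ... | c′ , h , tc′≡1+δh = SplittingIsomorphism.split-≅ r p q n δ E c′ h U≡ED NEc′≡P+hDP r∣⇒δ∣
    where
    E T P D N U : ℤ
    E = + e
    T = + t
    P = + p
    D = + δ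
    N = + n
    U = + (r / q)
    U≡ED : U ≡ E * D
    U≡ED = trans (cong +_ u≡eδ) (pos-* e δ)
    NE≡PT : N * E ≡ P * T
    NE≡PT = trans (sym (pos-* n e)) (trans (cong +_ ne≡pt) (pos-* p t))
    NEc′≡P+hDP : N * (E * c′) ≡ P + h * (D * P)
    NEc′≡P+hDP = begin
      N * (E * c′)       ≡⟨ *-assoc N E c′ ⟨
      N * E * c′         ≡⟨ cong (_* c′) NE≡PT ⟩
      P * T * c′         ≡⟨ *-assoc P T c′ ⟩
      P * (T * c′)       ≡⟨ cong (P *_) tc′≡1+δh ⟩
      P * (1ℤ + D * h)   ≡⟨ ring P D h ⟩
      P + h * (D * P)    ∎
      where
      open ≡-Reasoning
      ring : ∀ P D h → P * (1ℤ + D * h) ≡ P + h * (D * P)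
      ring = solve-∀
    DP∣r : D * P ∣ + r
    DP∣r = subst (_∣ + r) (pos-* δ p) (∣ᵤ⇒∣ {+ (δ ℕ.* p)} {+ r} δp∣r)
    DP∣NkU : ∀ k → D * P ∣ N * (k * U)
    DP∣NkU k = divides (k * T) (begin
      N * (k * U)        ≡⟨ cong (λ z → N * (k * z)) U≡ED ⟩
      N * (k * (E * D))  ≡⟨ ring₁ N k E D ⟩
      k * D * (N * E)    ≡⟨ cong (k * D *_) NE≡PT ⟩
      k * D * (P * T)    ≡⟨ ring₂ k D P T ⟩
      k * T * (D * P)    ∎)
      where
      open ≡-Reasoning
      ring₁ : ∀ N k E D → N * (k * (E * D)) ≡ k * D * (N * E)
      ring₁ = solve-∀
      ring₂ : ∀ k D P T → k * D * (P * T) ≡ k * T * (D * P)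
      ring₂ = solve-∀
    r∣⇒δ∣ : ∀ x k → + r ∣ P * x - N * (k * U) → D ∣ x
    r∣⇒δ∣ x k r∣px-nku = *-cancelˡ-∣ P (subst₂ _∣_ (*-comm D P) (ring (P * x) (N * (k * U)))
      (∣m∣n⇒∣m+n (∣-trans DP∣r r∣px-nku) (DP∣NkU k)))
      where
      ring : ∀ X Y → X - Y + Y ≡ X
      ring = solve-∀

open import Defs
open import Data.Nat using (ℕ; NonZero; _*_)
open import Data.Nat.DivMod using (_/_)
open import Data.Nat.Properties using (m*n≢0)
open import Data.Nat.Divisibility using (_∣_)
open import Data.Nat.GCD using (gcd)
open import Data.Nat.Primality using (Prime)
open import Data.Product using (_×_)
open import Relation.Nullary using (¬_)
open import Relation.Binary.PropositionalEquality using (_≡_)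

open import Data.Nat using (zero; suc; _^_; _≟_)
open import Data.Nat.Properties using (*-comm; *-assoc; *-cancelʳ-≡; m*n≢0⇒m≢0; m*n≢0⇒n≢0)
open import Data.Nat.Divisibility
  using (divides; quotient; m∣n⇒n≡quotient*m; ∣-trans; 1∣_; n∣m*n; m∣m*n; ∣m⇒∣m*n; m*n∣⇒m∣; *-monoʳ-∣; *-cancelˡ-∣; m∣n/o⇒m*o∣n)
open import Data.Nat.DivMod using (m*[n/m]≡n; m/n*n≡m)
open import Data.Nat.GCD using (GCD; gcd-GCD; GCD-*; gcd[m,n]∣m; gcd[m,n]∣n)
open import Data.Nat.Coprimality using (Coprime)
open import Data.Nat.Primality using (euclidsLemma; prime⇒nonZero; prime[2])
open import Data.Nat.Primality.Factorisation using (factorise)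
open import Data.Nat.ListAction using (product)
open import Data.Nat.Tactic.RingSolver using (solve-∀)
open import Data.List using ([]; _∷_)
open import Data.List.Relation.Unary.All using (_∷_)
open import Data.Product using (∃; _,_; proj₁; proj₂)
open import Data.Sum using (inj₁; inj₂)
open import Data.Empty using (⊥; ⊥-elim)
open import Relation.Nullary using (yes; no; contradiction)
open Splitting using (G-splits)
open import Relation.Binary.PropositionalEquality using (_≢_; refl; sym; trans; cong; subst; module ≡-Reasoning)

prime^∣m*n⇒^∣n : ∀ {ℓ m} → Prime ℓ → ¬ ℓ ∣ m → ∀ k {n} → ℓ ^ k ∣ m * n → ℓ ^ k ∣ n
prime^∣m*n⇒^∣n pr ℓ∤m zero    _ = 1∣ _
prime^∣m*n⇒^∣n {ℓ} {m} pr ℓ∤m (suc k) {n} ℓ^[1+k]∣mn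
  with euclidsLemma m n pr (m*n∣⇒m∣ ℓ (ℓ ^ k) ℓ^[1+k]∣mn)
... | inj₁ ℓ∣m = contradiction ℓ∣m ℓ∤m
... | inj₂ (divides n′ refl) = subst (ℓ * ℓ ^ k ∣_) (*-comm ℓ n′) (*-monoʳ-∣ ℓ ℓ^k∣n′)
  where
  instance _ = prime⇒nonZero pr
  ring : ∀ m n′ ℓ → m * (n′ * ℓ) ≡ ℓ * (m * n′)
  ring = solve-∀
  ℓ^k∣n′ : ℓ ^ k ∣ n′
  ℓ^k∣n′ = prime^∣m*n⇒^∣n pr ℓ∤m k (*-cancelˡ-∣ ℓ (subst (ℓ * ℓ ^ k ∣_) (ring m n′ ℓ) ℓ^[1+k]∣mn))

sameMultiplicity-cofactors : ∀ {ℓ m n a b} → Prime ℓ → ¬ ℓ ∣ a → ¬ ℓ ∣ b →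
                             m * a ≡ n * b → SameMultiplicity ℓ m n
sameMultiplicity-cofactors {ℓ} {m} {n} {a} {b} pr ℓ∤a ℓ∤b ma≡nb k =
  (λ ℓ^k∣m → prime^∣m*n⇒^∣n pr ℓ∤b k (subst (ℓ ^ k ∣_) (trans ma≡nb (*-comm n b)) (∣m⇒∣m*n a ℓ^k∣m))) ,
  (λ ℓ^k∣n → prime^∣m*n⇒^∣n pr ℓ∤a k (subst (ℓ ^ k ∣_) (trans (sym ma≡nb) (*-comm m a)) (∣m⇒∣m*n b ℓ^k∣n)))

∃-prime-divisor : ∀ i → i ≢ 1 → ∃ λ ℓ → Prime ℓ × ℓ ∣ i
∃-prime-divisor zero    _   = 2 , prime[2] , divides 0 refl
∃-prime-divisor (suc i) i≢1 with factorise (suc i)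
... | record { factors = [] ; isFactorisation = i≡1 } = contradiction i≡1 i≢1
... | record { factors = ℓ ∷ ℓs ; isFactorisation = i≡ℓ*Πℓs ; factorsPrime = pr ∷ _ } =
  ℓ , pr , subst (ℓ ∣_) (sym i≡ℓ*Πℓs) (m∣m*n (product ℓs))

coprime-if-no-common-prime : ∀ {m n} → (∀ ℓ → Prime ℓ → ℓ ∣ m → ℓ ∣ n → ⊥) → Coprime m n
coprime-if-no-common-prime no-common {i} (i∣m , i∣n) with i ≟ 1
... | yes i≡1 = i≡1
... | no  i≢1 with ∃-prime-divisor i i≢1
...   | ℓ , pr , ℓ∣i = ⊥-elim (no-common ℓ pr (∣-trans ℓ∣i i∣m) (∣-trans ℓ∣i i∣n))

∣-nonZero : ∀ {m n} .{{_ : NonZero n}} → m ∣ n → NonZero m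
∣-nonZero (divides k refl) = m*n≢0⇒n≢0 k

gcd≡a*b⇒b∣ : ∀ m n a {b} → gcd m n ≡ a * b → b ∣ m × b ∣ n
gcd≡a*b⇒b∣ m n a gcd≡ab = ∣-trans b∣gcd (gcd[m,n]∣m m n) , ∣-trans b∣gcd (gcd[m,n]∣n m n)
  where b∣gcd = subst (_ ∣_) (sym gcd≡ab) (n∣m*n a)

GCD-of-cofactors : ∀ {m n t e g δ} .{{_ : NonZero δ}} →
                   m ≡ t * δ → n ≡ e * δ → gcd m n ≡ g * δ → GCD t e g
GCD-of-cofactors {m} {n} refl refl gcd≡gδ = GCD-* (subst (GCD m n) gcd≡gδ (gcd-GCD m n))

cancel-common-factor : ∀ a b {x y t s c} .{{_ : NonZero c}} →
                       x ≡ t * c → y ≡ s * c → a * x ≡ b * y → a * t ≡ b * s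
cancel-common-factor a b {t = t} {s} {c} refl refl ax≡by =
  *-cancelʳ-≡ (a * t) (b * s) c (trans (*-assoc a t c) (trans ax≡by (sym (*-assoc b s c))))

n*[r/q]≡p*M : ∀ {r p q n u M} .{{_ : NonZero q}} → q * u ≡ r → M * (p * q) ≡ r * n → n * u ≡ p * M
n*[r/q]≡p*M {r} {p} {q} {n} {u} {M} qu≡r M[pq]≡rn = *-cancelʳ-≡ (n * u) (p * M) q (begin
  n * u * q    ≡⟨ ring₁ n u q ⟩
  (q * u) * n  ≡⟨ cong (_* n) qu≡r ⟩
  r * n        ≡⟨ M[pq]≡rn ⟨
  M * (p * q)  ≡⟨ ring₂ M p q ⟩
  p * M * q    ∎)
  where
  open ≡-Reasoning
  ring₁ : ∀ n u q → n * u * q ≡ (q * u) * n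
  ring₁ = solve-∀
  ring₂ : ∀ M p q → M * (p * q) ≡ p * M * q
  ring₂ = solve-∀

coprime-cofactor : ∀ {p q t e e′ g δ} → GCD t e g → GCD t e′ g → p * e′ ≡ q * e →
                   (∀ ℓ → Prime ℓ → ℓ ∣ g → SameMultiplicity ℓ p q) →
                   (∀ ℓ → Prime ℓ → ℓ ∣ δ → ¬ SameMultiplicity ℓ p q) →
                   Coprime t δ
coprime-cofactor {p} {q} {t} {g = g} {δ} gcd[t,e] gcd[t,e′] pe′≡qe same differ =
  coprime-if-no-common-prime common-prime-impossible
  where
  common-prime-impossible : ∀ ℓ → Prime ℓ → ℓ ∣ t → ℓ ∣ δ → ⊥
  common-prime-impossible ℓ pr ℓ∣t ℓ∣δ =
    differ ℓ pr ℓ∣δ (sameMultiplicity-cofactors pr (ℓ∤ gcd[t,e′]) (ℓ∤ gcd[t,e]) pe′≡qe)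
    where
    ℓ∤ : ∀ {x} → GCD t x g → ¬ ℓ ∣ x
    ℓ∤ gcd[t,x] ℓ∣x = differ ℓ pr ℓ∣δ (same ℓ pr (GCD.greatest gcd[t,x] (ℓ∣t , ℓ∣x)))

proposition4p4 : (r p q n : ℕ) → .{{_ : NonZero r}} → .{{_ : NonZero p}} → .{{_ : NonZero q}} → .{{_ : NonZero n}} →
    p ∣ r → q ∣ r → (p * q) ∣ (r * n) →
    (δ₁ δ₂ : ℕ) →
    gcd (_/_ (r * n) (p * q) {{m*n≢0 p q}}) (r / q) ≡ δ₁ * δ₂ →
    gcd (_/_ (r * n) (p * q) {{m*n≢0 p q}}) (r / p) ≡ δ₁ * δ₂ →
    (∀ ℓ → Prime ℓ → ℓ ∣ δ₁ → SameMultiplicity ℓ p q) →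
    (∀ ℓ → Prime ℓ → ℓ ∣ δ₂ → ¬ SameMultiplicity ℓ p q) →
    G r p q n ≅ (G r (δ₂ * p) q n ⊗ C δ₂)
proposition4p4 r p q n p∣r q∣r pq∣rn δ₁ δ₂ gcd[M,u]≡δ₁δ₂ gcd[M,w]≡δ₁δ₂ same differ =
  G-splits r p q n δ₂ e t u≡eδ₂ ne≡pt t⊥δ₂ δ₂p∣r
  where
  u w M : ℕ
  u = r / q
  w = r / p
  M = _/_ (r * n) (p * q) {{m*n≢0 p q}}
  δ₂∣M : δ₂ ∣ M
  δ₂∣M = proj₁ (gcd≡a*b⇒b∣ M u δ₁ gcd[M,u]≡δ₁δ₂)
  δ₂∣u : δ₂ ∣ u
  δ₂∣u = proj₂ (gcd≡a*b⇒b∣ M u δ₁ gcd[M,u]≡δ₁δ₂)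
  δ₂∣w : δ₂ ∣ w
  δ₂∣w = proj₂ (gcd≡a*b⇒b∣ M w δ₁ gcd[M,w]≡δ₁δ₂)
  δ₂p∣r : δ₂ * p ∣ r
  δ₂p∣r = m∣n/o⇒m*o∣n p∣r δ₂∣w
  instance
    δ₂≢0 : NonZero δ₂
    δ₂≢0 = m*n≢0⇒m≢0 δ₂ {{∣-nonZero δ₂p∣r}}
  t e e′ : ℕ
  t = quotient δ₂∣M
  e = quotient δ₂∣u
  e′ = quotient δ₂∣w
  M≡tδ₂ : M ≡ t * δ₂
  M≡tδ₂ = m∣n⇒n≡quotient*m δ₂∣M
  u≡eδ₂ : u ≡ e * δ₂
  u≡eδ₂ = m∣n⇒n≡quotient*m δ₂∣u
  w≡e′δ₂ : w ≡ e′ * δ₂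
  w≡e′δ₂ = m∣n⇒n≡quotient*m δ₂∣w
  ne≡pt : n * e ≡ p * t
  ne≡pt = cancel-common-factor n p u≡eδ₂ M≡tδ₂
            (n*[r/q]≡p*M {p = p} {M = M} (m*[n/m]≡n q∣r) (m/n*n≡m {{m*n≢0 p q}} pq∣rn))
  pe′≡qe : p * e′ ≡ q * e
  pe′≡qe = cancel-common-factor p q w≡e′δ₂ u≡eδ₂ (trans (m*[n/m]≡n p∣r) (sym (m*[n/m]≡n q∣r)))
  t⊥δ₂ : Coprime t δ₂
  t⊥δ₂ = coprime-cofactor (GCD-of-cofactors M≡tδ₂ u≡eδ₂ gcd[M,u]≡δ₁δ₂)
                          (GCD-of-cofactors M≡tδ₂ w≡e′δ₂ gcd[M,w]≡δ₁δ₂)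
                          pe′≡qe same differ
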